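{- Let $G$ and $H$ be two finite simple digraphs with $\Delta^+(G)\geq 1$ and $\Delta^+(H)\geq 1$. Then (i) $\gamma_I(G\rightarrow H)=\gamma_I(G)$, and (ii) $r_I(G\rightarrow H)=r_I(G)$.
   Context: For vertex-disjoint digraphs $G$ and $H$, $G\rightarrow H$ is the digraph consisting of $G$ and $H$ together with extra arcs from each vertex of $G$ to every vertex of $H$. $\Delta^+$ denotes maximum out-degree. An Italian dominating function (IDF) on a digraph $D$ is a function $f:V(D)\to\{0,1,2\}$ such that every vertex $v$ with $f(v)=0$ has at least two in-neighbors $w$ with $f(w)=1$ or at least one in-neighbor $w$ with $f(w)=2$; its weight is $\sum_u f(u)$ and $\gamma_I(D)$ is the minimum weight of an IDF. For a set $R$ of arcs not in $A(D)$ (between distinct vertices), $D+R$ is $D$ with these arcs added; $R$ is an Italian reinforcement set if $\gamma_I(D+R)<\gamma_I(D)$. The Italian reinforcement number $r_I(D)$ is the minimum size of such a set, defined to be $0$ if $\gamma_I(D)\leq 2$. -}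

module Defs where

open import Data.Nat using (ℕ; zero; suc; _+_; _≤_; _<_; _⊔_)
open import Data.Bool using (Bool; true; false; _∨_; if_then_else_)
open import Data.Fin using (Fin; splitAt)
open import Data.List using (List; map; foldr; allFin)
open import Data.Nat.ListAction using (sum)
open import Data.Product using (Σ; ∃; _×_; _,_)
open import Data.Sum using (_⊎_; inj₁; inj₂)
open import Relation.Binary.PropositionalEquality using (_≡_; _≢_)

Σv : ∀ {n} → (Fin n → ℕ) → ℕ
Σv {n} f = sum (map f (allFin n))

-- Maximum of a function over Fin n (0 for the empty vertex set).
maxv : ∀ {n} → (Fin n → ℕ) → ℕ
maxv {n} f = foldr _⊔_ 0 (map f (allFin n))

-- A finite simple digraph: vertex set Fin n, arc relation given by a Boolean
-- adjacency function (no parallel arcs by construction), and no loops.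
record Digraph : Set where
  field
    n        : ℕ
    arc      : Fin n → Fin n → Bool
    loopless : ∀ v → arc v v ≡ false
open Digraph public

b2n : Bool → ℕ
b2n true  = 1
b2n false = 0

outDeg : (D : Digraph) → Fin (n D) → ℕ
outDeg D v = Σv (λ w → b2n (arc D v w))

Δ⁺ : Digraph → ℕ
Δ⁺ D = maxv (outDeg D)

-- G → H : disjoint union plus all arcs from V(G) to V(H).
-- Vertices of G are the first n G elements of Fin (n G + n H).
joinArc : (G H : Digraph) → Fin (n G + n H) → Fin (n G + n H) → Bool
joinArc G H u v with splitAt (n G) u | splitAt (n G) v
... | inj₁ a | inj₁ b = arc G a b
... | inj₂ a | inj₂ b = arc H a b
... | inj₁ _ | inj₂ _ = true
... | inj₂ _ | inj₁ _ = false

joinLoopless : (G H : Digraph) → ∀ v → joinArc G H v v ≡ false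
joinLoopless G H v with splitAt (n G) v
... | inj₁ a = loopless G a
... | inj₂ a = loopless H a

_⇒_ : Digraph → Digraph → Digraph
G ⇒ H = record { n = n G + n H ; arc = joinArc G H ; loopless = joinLoopless G H }

IsIDF : (D : Digraph) → (Fin (n D) → ℕ) → Set
IsIDF D f =
  (∀ v → f v ≤ 2) ×
  (∀ v → f v ≡ 0 →
     (∃ λ w → arc D w v ≡ true × f w ≡ 2)
     ⊎ (∃ λ w₁ → ∃ λ w₂ → w₁ ≢ w₂ × arc D w₁ v ≡ true × arc D w₂ v ≡ true
                          × f w₁ ≡ 1 × f w₂ ≡ 1))

weight : (D : Digraph) → (Fin (n D) → ℕ) → ℕ
weight D f = Σv f

IsγI : Digraph → ℕ → Set
IsγI D k = (∃ λ f → IsIDF D f × weight D f ≡ k)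
         × (∀ f → IsIDF D f → k ≤ weight D f)

record ArcSet (D : Digraph) : Set where
  field
    rarc     : Fin (n D) → Fin (n D) → Bool
    rloop    : ∀ v → rarc v v ≡ false
    disjoint : ∀ u v → rarc u v ≡ true → arc D u v ≡ false
open ArcSet public

size : {D : Digraph} → ArcSet D → ℕ
size R = Σv (λ u → Σv (λ v → b2n (rarc R u v)))

addArcs : (D : Digraph) → ArcSet D → Digraph
addArcs D R = record
  { n = n D
  ; arc = λ u v → arc D u v ∨ rarc R u v
  ; loopless = λ v → helper (arc D v v) (rarc R v v) (loopless D v) (rloop R v) }
  where
  helper : ∀ a b → a ≡ false → b ≡ false → (a ∨ b) ≡ false
  helper false false _ _ = _≡_.refl

IsReinf : (D : Digraph) → ArcSet D → Set
IsReinf D R = ∃ λ k → ∃ λ k' → IsγI D k × IsγI (addArcs D R) k' × k' < k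

IsrI : Digraph → ℕ → Set
IsrI D r =
  (∃ λ k → IsγI D k × k ≤ 2 × r ≡ 0)
  ⊎ ((∃ λ k → IsγI D k × 3 ≤ k)
     × (∃ λ R → IsReinf D R × size R ≡ r)
     × (∀ R → IsReinf D R → r ≤ size R))

-- With values in {0,1,2}, the Italian condition at v says exactly that the in-neighbours
-- of v carry total weight at least 2. In G → H every vertex of H has all of V(G) as
-- in-neighbours and no arc goes back from H to G, while an IDF on at least two vertices
-- (guaranteed by Δ⁺(G) ≥ 1 and looplessness) has weight at least 2. Hence restricting an
-- IDF of G → H to V(G), or extending an IDF of G by zeros on V(H), gives an IDF again, and
-- γ_I(G → H) = γ_I(G). A reinforcement set of G is one of G → H of the same size.
-- Conversely, if R reinforces G → H, an IDF f of (G → H) + R has weight below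
-- γ_I(G) ≤ |V(G)|, so f vanishes at some x ∈ V(G). Moving the weight of f on V(H), capped
-- at 2, onto x, and replacing the arcs of R from V(H) into V(G) by arcs out of x, gives an
-- IDF of G + R′ for an arc set R′ with |R′| ≤ |R|.

module Submission where

open import Defs
open import Data.Nat using (ℕ; zero; suc; _+_; _*_; _≤_; _<_; _⊓_; z≤n; s≤s; s≤s⁻¹; _≤?_; _<?_)
open import Data.Nat.Properties
open import Data.Nat.Induction using (<-rec)
import Data.Nat.ListAction as List
open import Data.Bool using (Bool; true; false; _∨_; _∧_; not)
import Data.Bool.Properties as Bool
open import Data.Fin using (Fin; zero; suc; toℕ; fromℕ<; _↑ˡ_; _↑ʳ_; splitAt)
open import Data.Fin.Properties
  using (any?; all?; toℕ≤pred[n]; toℕ-fromℕ<; splitAt-↑ˡ; splitAt-↑ʳ)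
  renaming (_≟_ to _≟ᶠ_; suc-injective to Fin-suc-injective)
open import Data.List using (tabulate)
open import Data.List.Properties using (map-tabulate)
open import Data.Vec.Functional using (Vector; []; _∷_; _++_; replicate; updateAt)
open import Data.Vec.Functional.Properties
  using (updateAt-updates; updateAt-minimal; lookup-++ˡ; lookup-++ʳ)
open import Algebra.Properties.CommutativeMonoid.Sum +-0-commutativeMonoid
  using (sum; sum-syntax; sum-cong-≗; ∑-distrib-+; ∑-comm; sum-replicate-zero)
open import Algebra.Properties.CommutativeSemigroup +-commutativeSemigroup using (xy∙z≈xz∙y)
open import Data.Product using (Σ; ∃; ∃₂; _×_; _,_; proj₁; proj₂; uncurry)
open import Data.Sum using (_⊎_; inj₁; inj₂)
open import Function using (_∘_)
open import Function.Bundles using (_⇔_; mk⇔; Equivalence)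
open import Relation.Nullary using (Dec; yes; no; does; contradiction)
open import Relation.Nullary.Decidable using (map′; _×-dec_; _→-dec_; dec-true; dec-false)
open import Relation.Binary.Definitions using (_Respects_)
open import Relation.Binary.PropositionalEquality

-- Finite sums over Fin n

Σv≡∑ : ∀ {n} (f : Vector ℕ n) → Σv f ≡ sum f
Σv≡∑ {n} f = trans (cong List.sum (map-tabulate (λ i → i) f)) (sum-tabulate f)
  where
  sum-tabulate : ∀ {m} (g : Vector ℕ m) → List.sum (tabulate g) ≡ sum g
  sum-tabulate {zero} g = refl
  sum-tabulate {suc m} g = cong (g zero +_) (sum-tabulate (g ∘ suc))

∑-mono-≤ : ∀ {n} {f g : Vector ℕ n} → (∀ i → f i ≤ g i) → sum f ≤ sum g
∑-mono-≤ {zero} _ = z≤n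
∑-mono-≤ {suc n} f≤g = +-mono-≤ (f≤g zero) (∑-mono-≤ (f≤g ∘ suc))

∑-splitAt : ∀ m {n} (f : Vector ℕ (m + n)) →
            sum f ≡ sum (λ i → f (i ↑ˡ n)) + sum (λ j → f (m ↑ʳ j))
∑-splitAt zero f = refl
∑-splitAt (suc m) f = trans (cong (f zero +_) (∑-splitAt m (f ∘ suc))) (sym (+-assoc (f zero) _ _))

∑-↑ˡ-≤ : ∀ m {n} (f : Vector ℕ (m + n)) → sum (λ i → f (i ↑ˡ n)) ≤ sum f
∑-↑ˡ-≤ m {n} f = subst (sum (λ i → f (i ↑ˡ n)) ≤_) (sym (∑-splitAt m f)) (m≤m+n _ _)

∑-supported-↑ˡ : ∀ m {n} (f : Vector ℕ (m + n)) → (∀ j → f (m ↑ʳ j) ≡ 0) →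
                 sum f ≡ sum (λ i → f (i ↑ˡ n))
∑-supported-↑ˡ m {n} f f↑ʳ≡0 = begin
  sum f                         ≡⟨ ∑-splitAt m f ⟩
  ∑f↑ˡ + sum (λ j → f (m ↑ʳ j))  ≡⟨ cong (∑f↑ˡ +_) (sum-cong-≗ f↑ʳ≡0) ⟩
  ∑f↑ˡ + sum (replicate n 0)     ≡⟨ cong (∑f↑ˡ +_) (sum-replicate-zero n) ⟩
  ∑f↑ˡ + 0                       ≡⟨ +-identityʳ ∑f↑ˡ ⟩
  ∑f↑ˡ                           ∎
  where
  open ≡-Reasoning
  ∑f↑ˡ : ℕ
  ∑f↑ˡ = sum (λ i → f (i ↑ˡ n))

≤-∑ : ∀ {n} (f : Vector ℕ n) i → f i ≤ sum f
≤-∑ f zero = m≤m+n _ _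
≤-∑ f (suc i) = ≤-trans (≤-∑ (f ∘ suc) i) (m≤n+m _ _)

∑-pair : ∀ {n} (f : Vector ℕ n) i j → i ≢ j → f i + f j ≤ sum f
∑-pair f zero zero 0≢0 = contradiction refl 0≢0
∑-pair f zero (suc j) _ = +-monoʳ-≤ (f zero) (≤-∑ (f ∘ suc) j)
∑-pair f (suc i) zero _ = subst (_≤ sum f) (+-comm (f zero) _) (+-monoʳ-≤ (f zero) (≤-∑ (f ∘ suc) i))
∑-pair f (suc i) (suc j) i≢j = ≤-trans (∑-pair (f ∘ suc) i j (i≢j ∘ cong suc)) (m≤n+m _ _)

∑-focus : ∀ {n} (f : Vector ℕ n) i → (∀ j → j ≢ i → f j ≡ 0) → sum f ≡ f i
∑-focus {suc n} f zero rest =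
  trans (cong (f zero +_) (trans (sum-cong-≗ (λ j → rest (suc j) λ ())) (sum-replicate-zero n)))
        (+-identityʳ _)
∑-focus f (suc i) rest rewrite rest zero (λ ()) =
  ∑-focus (f ∘ suc) i (λ j j≢i → rest (suc j) (j≢i ∘ Fin-suc-injective))

∑-updateAt-+ : ∀ {n} (f : Vector ℕ n) i c → sum (updateAt f i (_+ c)) ≡ sum f + c
∑-updateAt-+ f zero c = xy∙z≈xz∙y (f zero) c _
∑-updateAt-+ f (suc i) c =
  trans (cong (f zero +_) (∑-updateAt-+ (f ∘ suc) i c)) (sym (+-assoc (f zero) _ c))

∑-ones : ∀ n → sum (replicate n 1) ≡ n
∑-ones zero = refl
∑-ones (suc n) = cong suc (∑-ones n)

∑-positive : ∀ {n} (f : Vector ℕ n) → 0 < sum f → ∃ λ i → 0 < f i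
∑-positive {suc n} f 0<∑ with f zero in eq
... | suc _ = zero , subst (0 <_) (sym eq) (s≤s z≤n)
... | zero = let i , 0<fi = ∑-positive (f ∘ suc) 0<∑ in suc i , 0<fi

∑<n⇒∃≡0 : ∀ {n} (f : Vector ℕ n) → sum f < n → ∃ λ i → f i ≡ 0
∑<n⇒∃≡0 {suc n} f ∑<n with f zero in eq
... | zero = zero , eq
... | suc c =
  let i , fi≡0 = ∑<n⇒∃≡0 (f ∘ suc) (≤-<-trans (m≤n+m _ c) (s≤s⁻¹ ∑<n)) in suc i , fi≡0

two-or-pair : ∀ {n} (f : Vector ℕ n) → (∀ i → f i ≤ 2) → 2 ≤ sum f →
              (∃ λ i → f i ≡ 2) ⊎ (∃₂ λ i j → i ≢ j × f i ≡ 1 × f j ≡ 1)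
two-or-pair {suc n} f f≤2 2≤∑ with f zero in eq | f≤2 zero
... | 2 | _ = inj₁ (zero , eq)
... | suc (suc (suc _)) | s≤s (s≤s ())
... | 0 | _ with two-or-pair (f ∘ suc) (f≤2 ∘ suc) 2≤∑
...   | inj₁ (i , fi≡2) = inj₁ (suc i , fi≡2)
...   | inj₂ (i , j , i≢j , fi≡1 , fj≡1) =
  inj₂ (suc i , suc j , i≢j ∘ Fin-suc-injective , fi≡1 , fj≡1)
two-or-pair {suc n} f f≤2 (s≤s 1≤∑) | 1 | _ with ∑-positive (f ∘ suc) 1≤∑
... | j , 0<fj with f (suc j) in eqj | f≤2 (suc j)
...   | 1 | _ = inj₂ (zero , suc j , (λ ()) , eq , eqj)
...   | 2 | _ = inj₁ (suc j , eqj)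
...   | suc (suc (suc _)) | s≤s (s≤s ())

∨≡true : ∀ a {b} → a ∨ b ≡ true → a ≡ true ⊎ b ≡ true
∨≡true true _ = inj₁ refl
∨≡true false b≡true = inj₂ b≡true

≤-+-⊓ : ∀ {k} a b → k ≤ a + b → k ≤ a + b ⊓ k
≤-+-⊓ {k} a b k≤a+b with ≤-total b k
... | inj₁ b≤k = subst (λ t → k ≤ a + t) (sym (m≤n⇒m⊓n≡m b≤k)) k≤a+b
... | inj₂ k≤b = subst (λ t → k ≤ a + t) (sym (m≥n⇒m⊓n≡n k≤b)) (m≤n+m k a)

b2n-mono : ∀ {a b} → (a ≡ true → b ≡ true) → b2n a ≤ b2n b
b2n-mono {false} _ = z≤n
b2n-mono {true} a⇒b rewrite a⇒b refl = ≤-refl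

b2n-∨ : ∀ a b → b2n (a ∨ b) ≤ b2n a + b2n b
b2n-∨ true _ = s≤s z≤n
b2n-∨ false _ = ≤-refl

b2n-*-≤ : ∀ b x → b2n b * x ≤ x
b2n-*-≤ true x = ≤-reflexive (*-identityˡ x)
b2n-*-≤ false x = z≤n

b2n-*-positive : ∀ b x → 0 < b2n b * x → b ≡ true
b2n-*-positive true _ _ = refl

b2n-*-≡suc : ∀ b x {y} → b2n b * x ≡ suc y → b ≡ true × x ≡ suc y
b2n-*-≡suc true x e = refl , trans (sym (*-identityˡ x)) e

-- Italian domination via in-weights

Adjacency : ℕ → Set
Adjacency N = Fin N → Fin N → Bool

ItalianDominated : ∀ {N} → Adjacency N → Vector ℕ N → Fin N → Set
ItalianDominated a f v =
  (∃ λ w → a w v ≡ true × f w ≡ 2)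
  ⊎ (∃ λ w₁ → ∃ λ w₂ → w₁ ≢ w₂ × a w₁ v ≡ true × a w₂ v ≡ true
                       × f w₁ ≡ 1 × f w₂ ≡ 1)

-- IsIDF D f and IsγI D k are, by definition, IsIDFOn (arc D) f and IsγIOn (arc D) k.
IsIDFOn : ∀ {N} → Adjacency N → Vector ℕ N → Set
IsIDFOn a f = (∀ v → f v ≤ 2) × (∀ v → f v ≡ 0 → ItalianDominated a f v)

IsγIOn : ∀ {N} → Adjacency N → ℕ → Set
IsγIOn a k = (∃ λ f → IsIDFOn a f × Σv f ≡ k) × (∀ f → IsIDFOn a f → k ≤ Σv f)

inWeight : ∀ {N} → Adjacency N → Vector ℕ N → Fin N → ℕ
inWeight {N} a f v = ∑[ w < N ] (b2n (a w v) * f w)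

inWeight≤∑ : ∀ {N} (a : Adjacency N) f v → inWeight a f v ≤ sum f
inWeight≤∑ a f v = ∑-mono-≤ (λ w → b2n-*-≤ (a w v) (f w))

inWeight-updateAt-+ : ∀ {N} (a : Adjacency N) g i c v →
  inWeight a (updateAt g i (_+ c)) v ≡ inWeight a g v + b2n (a i v) * c
inWeight-updateAt-+ a g i c v =
  trans (sum-cong-≗ pointwise) (∑-updateAt-+ (λ w → b2n (a w v) * g w) i (b2n (a i v) * c))
  where
  pointwise : ∀ w → b2n (a w v) * updateAt g i (_+ c) w
                  ≡ updateAt (λ w → b2n (a w v) * g w) i (_+ b2n (a i v) * c) w
  pointwise w with w ≟ᶠ i
  ... | yes refl = begin
    b2n (a w v) * updateAt g w (_+ c) w   ≡⟨ cong (b2n (a w v) *_) (updateAt-updates w g) ⟩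
    b2n (a w v) * (g w + c)               ≡⟨ *-distribˡ-+ (b2n (a w v)) (g w) c ⟩
    b2n (a w v) * g w + b2n (a w v) * c   ≡⟨ updateAt-updates w (λ w → b2n (a w v) * g w) ⟨
    updateAt (λ w → b2n (a w v) * g w) w (_+ b2n (a w v) * c) w ∎
    where open ≡-Reasoning
  ... | no w≢i = trans (cong (b2n (a w v) *_) (updateAt-minimal w i g w≢i))
                       (sym (updateAt-minimal w i (λ w → b2n (a w v) * g w) w≢i))

dominated⇒2≤inWeight : ∀ {N} (a : Adjacency N) {f v} →
                       ItalianDominated a f v → 2 ≤ inWeight a f v
dominated⇒2≤inWeight a {f} {v} (inj₁ (w , awv , fw≡2)) =
  subst (_≤ inWeight a f v) (cong₂ (λ b x → b2n b * x) awv fw≡2) (≤-∑ _ w)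
dominated⇒2≤inWeight a {f} {v} (inj₂ (w₁ , w₂ , w₁≢w₂ , aw₁v , aw₂v , fw₁≡1 , fw₂≡1)) =
  subst (_≤ inWeight a f v) (cong₂ _+_ (term≡ aw₁v fw₁≡1) (term≡ aw₂v fw₂≡1)) (∑-pair _ w₁ w₂ w₁≢w₂)
  where
  term≡ : ∀ {w} → a w v ≡ true → f w ≡ 1 → b2n (a w v) * f w ≡ 1
  term≡ awv fw≡1 = cong₂ (λ b x → b2n b * x) awv fw≡1

2≤inWeight⇒dominated : ∀ {N} (a : Adjacency N) {f v} →
                       (∀ w → f w ≤ 2) → 2 ≤ inWeight a f v → ItalianDominated a f v
2≤inWeight⇒dominated a {f} {v} f≤2 2≤in
  with two-or-pair (λ w → b2n (a w v) * f w) (λ w → ≤-trans (b2n-*-≤ (a w v) (f w)) (f≤2 w)) 2≤in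
... | inj₁ (w , e) = inj₁ (w , b2n-*-≡suc (a w v) (f w) e)
... | inj₂ (w₁ , w₂ , w₁≢w₂ , e₁ , e₂) =
  let aw₁v , fw₁≡1 = b2n-*-≡suc (a w₁ v) (f w₁) e₁
      aw₂v , fw₂≡1 = b2n-*-≡suc (a w₂ v) (f w₂) e₂
  in inj₂ (w₁ , w₂ , w₁≢w₂ , aw₁v , aw₂v , fw₁≡1 , fw₂≡1)

IDF-inWeight : ∀ {N} (a : Adjacency N) {f} → IsIDFOn a f →
               ∀ {v} → f v ≡ 0 → 2 ≤ inWeight a f v
IDF-inWeight a (_ , dominated) fv≡0 = dominated⇒2≤inWeight a (dominated _ fv≡0)

mkIDF : ∀ {N} (a : Adjacency N) {f} → (∀ v → f v ≤ 2) →
        (∀ v → f v ≡ 0 → 2 ≤ inWeight a f v) → IsIDFOn a f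
mkIDF a f≤2 heavy = f≤2 , λ v fv≡0 → 2≤inWeight⇒dominated a f≤2 (heavy v fv≡0)

IDF? : ∀ {N} (a : Adjacency N) f → Dec (IsIDFOn a f)
IDF? a f = map′ (uncurry (mkIDF a)) (λ idf → proj₁ idf , λ v → IDF-inWeight a idf)
  (all? (λ v → f v ≤? 2) ×-dec all? (λ v → (f v ≟ 0) →-dec (2 ≤? inWeight a f v)))

IDF-resp : ∀ {N} (a : Adjacency N) → IsIDFOn a Respects _≗_
IDF-resp a {f} {g} f≗g idf = mkIDF a (λ v → subst (_≤ 2) (f≗g v) (proj₁ idf v)) λ v gv≡0 →
  subst (2 ≤_) (sum-cong-≗ λ w → cong (b2n (a w v) *_) (f≗g w))
        (IDF-inWeight a idf (trans (f≗g v) gv≡0))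

IDF-ones : ∀ {N} (a : Adjacency N) → IsIDFOn a (replicate N 1)
IDF-ones a = (λ _ → s≤s z≤n) , λ _ ()

IDF-weight≥2 : ∀ {N} (a : Adjacency N) {f} → 2 ≤ N → IsIDFOn a f → 2 ≤ sum f
IDF-weight≥2 a {f} (s≤s (s≤s _)) idf with f zero ≟ 0 | f (suc zero) ≟ 0
... | yes f₀≡0 | _ = ≤-trans (IDF-inWeight a idf f₀≡0) (inWeight≤∑ a f zero)
... | no _ | yes f₁≡0 = ≤-trans (IDF-inWeight a idf f₁≡0) (inWeight≤∑ a f (suc zero))
... | no f₀≢0 | no f₁≢0 =
  ≤-trans (+-mono-≤ (n≢0⇒n>0 f₀≢0) (n≢0⇒n>0 f₁≢0)) (∑-pair f zero (suc zero) (λ ()))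

∃-bounded? : ∀ {n} b {P : Vector ℕ n → Set} → P Respects _≗_ →
             (∀ f → Dec (P f)) → Dec (∃ λ f → (∀ i → f i ≤ b) × P f)
∃-bounded? {zero} b resp P? =
  map′ (λ p → [] , (λ ()) , p) (λ (_ , _ , p) → resp (λ ()) p) (P? [])
∃-bounded? {suc n} b {P} resp P? =
  map′ cons uncons (any? λ c → ∃-bounded? b (λ g≗h → resp (∷-cong g≗h)) (P? ∘ (toℕ c ∷_)))
  where
  ∷-cong : ∀ {x} {g h : Vector ℕ n} → g ≗ h → (x ∷ g) ≗ (x ∷ h)
  ∷-cong g≗h zero = refl
  ∷-cong g≗h (suc i) = g≗h i
  cons : (∃ λ (c : Fin (suc b)) → ∃ λ g → (∀ i → g i ≤ b) × P (toℕ c ∷ g)) →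
         ∃ λ f → (∀ i → f i ≤ b) × P f
  cons (c , g , g≤b , p) = toℕ c ∷ g , (λ { zero → toℕ≤pred[n] c ; (suc i) → g≤b i }) , p
  uncons : (∃ λ f → (∀ i → f i ≤ b) × P f) →
           ∃ λ (c : Fin (suc b)) → ∃ λ g → (∀ i → g i ≤ b) × P (toℕ c ∷ g)
  uncons (f , f≤b , p) = fromℕ< (s≤s (f≤b zero)) , f ∘ suc , f≤b ∘ suc ,
    resp (λ { zero → sym (toℕ-fromℕ< (s≤s (f≤b zero))) ; (suc i) → refl }) p

-- Descent on the weight: a lighter IDF is searched for among all {0,1,2}-valued
-- functions; if there is none, the current one is minimum.
γI-exists : ∀ {N} (a : Adjacency N) → ∃ (IsγIOn a)
γI-exists {N} a = <-rec Goal descend _ (replicate N 1) (IDF-ones a) refl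
  where
  Goal : ℕ → Set
  Goal m = ∀ f → IsIDFOn a f → sum f ≡ m → ∃ (IsγIOn a)
  lighter? : ∀ m → Dec (∃ λ g → (∀ i → g i ≤ 2) × (IsIDFOn a g × sum g < m))
  lighter? m = ∃-bounded? 2
    (λ f≗g (idf , ∑f<m) → IDF-resp a f≗g idf , subst (_< m) (sum-cong-≗ f≗g) ∑f<m)
    (λ g → IDF? a g ×-dec (sum g <? m))
  descend : ∀ m → (∀ {m′} → m′ < m → Goal m′) → Goal m
  descend m lighter⇒ f idf refl with lighter? m
  ... | yes (g , _ , idg , ∑g<m) = lighter⇒ ∑g<m g idg refl
  ... | no none = m , (f , idf , Σv≡∑ f) , λ g idg →
    subst (m ≤_) (sym (Σv≡∑ g)) (≮⇒≥ λ ∑g<m → none (g , proj₁ idg , idg , ∑g<m))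

γI-transfer : ∀ {M N} {a : Adjacency M} {d : Adjacency N}
              (restrict : Vector ℕ N → Vector ℕ M) (extend : Vector ℕ M → Vector ℕ N) →
              (∀ f → IsIDFOn d f → IsIDFOn a (restrict f)) → (∀ f → sum (restrict f) ≤ sum f) →
              (∀ g → IsIDFOn a g → IsIDFOn d (extend g)) → (∀ g → sum (extend g) ≡ sum g) →
              ∀ k → IsγIOn d k ⇔ IsγIOn a k
γI-transfer {a = a} {d} r e r-IDF r-≤ e-IDF e-≡ k = mk⇔ to from
  where
  Σv-r : ∀ f → Σv (r f) ≤ Σv f
  Σv-r f = subst₂ _≤_ (sym (Σv≡∑ (r f))) (sym (Σv≡∑ f)) (r-≤ f)
  Σv-e : ∀ g → Σv (e g) ≡ Σv g
  Σv-e g = trans (Σv≡∑ (e g)) (trans (e-≡ g) (sym (Σv≡∑ g)))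
  to : IsγIOn d k → IsγIOn a k
  to ((f , idf , Σvf≡k) , minimum) =
    (r f , r-IDF f idf , ≤-antisym (subst (_ ≤_) Σvf≡k (Σv-r f)) (minimum′ _ (r-IDF f idf))) ,
    minimum′
    where
    minimum′ : ∀ g → IsIDFOn a g → k ≤ Σv g
    minimum′ g idg = subst (k ≤_) (Σv-e g) (minimum (e g) (e-IDF g idg))
  from : IsγIOn a k → IsγIOn d k
  from ((g , idg , Σvg≡k) , minimum) =
    (e g , e-IDF g idg , trans (Σv-e g) Σvg≡k) ,
    λ f idf → ≤-trans (minimum (r f) (r-IDF f idf)) (Σv-r f)

-- Joins

data ↑-View m n : Fin (m + n) → Set where
  left  : ∀ i → ↑-View m n (i ↑ˡ n)
  right : ∀ j → ↑-View m n (m ↑ʳ j)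

↑-view : ∀ m {n} u → ↑-View m n u
↑-view zero u = right u
↑-view (suc m) zero = left zero
↑-view (suc m) (suc u) with ↑-view m u
... | left i = left (suc i)
... | right j = right j

record IsJoin {m n} (a : Adjacency m) (d : Adjacency (m + n)) : Set where
  field
    inside   : ∀ u v → d (u ↑ˡ n) (v ↑ˡ n) ≡ a u v
    forward  : ∀ u w → d (u ↑ˡ n) (m ↑ʳ w) ≡ true
    backward : ∀ w v → d (m ↑ʳ w) (v ↑ˡ n) ≡ false

module _ {m n} {a : Adjacency m} {d : Adjacency (m + n)} (J : IsJoin a d) where
  open IsJoin J

  inWeight-↑ˡ : ∀ f v → inWeight d f (v ↑ˡ n) ≡ inWeight a (λ u → f (u ↑ˡ n)) v
  inWeight-↑ˡ f v =
    trans (∑-supported-↑ˡ m _ λ w → cong (λ b → b2n b * f (m ↑ʳ w)) (backward w v))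
          (sum-cong-≗ λ u → cong (λ b → b2n b * f (u ↑ˡ n)) (inside u v))

  ∑↑ˡ≤inWeight-↑ʳ : ∀ f w → sum (λ u → f (u ↑ˡ n)) ≤ inWeight d f (m ↑ʳ w)
  ∑↑ˡ≤inWeight-↑ʳ f w = subst (_≤ inWeight d f (m ↑ʳ w))
    (sum-cong-≗ λ u → trans (cong (λ b → b2n b * f (u ↑ˡ n)) (forward u w)) (*-identityˡ _))
    (∑-↑ˡ-≤ m (λ x → b2n (d x (m ↑ʳ w)) * f x))

  restrictIDF : ∀ f → IsIDFOn d f → IsIDFOn a (λ u → f (u ↑ˡ n))
  restrictIDF f idf = mkIDF a (λ u → proj₁ idf (u ↑ˡ n)) λ v fv≡0 →
    subst (2 ≤_) (inWeight-↑ˡ f v) (IDF-inWeight d idf fv≡0)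

  ∑-padded : ∀ g → sum (g ++ replicate n 0) ≡ sum g
  ∑-padded g = trans (∑-supported-↑ˡ m (g ++ replicate n 0) (lookup-++ʳ g (replicate n 0)))
                     (sum-cong-≗ (lookup-++ˡ g (replicate n 0)))

  padIDF : 2 ≤ m → ∀ g → IsIDFOn a g → IsIDFOn d (g ++ replicate n 0)
  padIDF 2≤m g idg = mkIDF d bounded heavy
    where
    g′ : Vector ℕ (m + n)
    g′ = g ++ replicate n 0
    bounded : ∀ u → g′ u ≤ 2
    bounded u with ↑-view m u
    ... | left i = subst (_≤ 2) (sym (lookup-++ˡ g _ i)) (proj₁ idg i)
    ... | right j = subst (_≤ 2) (sym (lookup-++ʳ g _ j)) z≤n
    heavy : ∀ u → g′ u ≡ 0 → 2 ≤ inWeight d g′ u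
    heavy u g′u≡0 with ↑-view m u
    ... | left i = subst (2 ≤_)
      (sym (trans (inWeight-↑ˡ g′ i) (sum-cong-≗ λ u → cong (b2n (a u i) *_) (lookup-++ˡ g _ u))))
      (IDF-inWeight a idg (trans (sym (lookup-++ˡ g _ i)) g′u≡0))
    ... | right j = ≤-trans (subst (2 ≤_) (sym (sum-cong-≗ (lookup-++ˡ g _))) (IDF-weight≥2 a 2≤m idg))
                            (∑↑ˡ≤inWeight-↑ʳ g′ j)

  γI-join : 2 ≤ m → ∀ k → IsγIOn d k ⇔ IsγIOn a k
  γI-join 2≤m = γI-transfer (λ f u → f (u ↑ˡ n)) (λ g → g ++ replicate n 0)
    restrictIDF (∑-↑ˡ-≤ m) (padIDF 2≤m) ∑-padded

-- Arc sets and reinforcement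

Δ⁺≥1⇒2≤n : ∀ G → 1 ≤ Δ⁺ G → 2 ≤ n G
Δ⁺≥1⇒2≤n record { n = 0 } ()
Δ⁺≥1⇒2≤n record { n = 1 ; arc = a ; loopless = l } 1≤Δ⁺ with a zero zero | l zero
... | false | refl with 1≤Δ⁺
...   | ()
Δ⁺≥1⇒2≤n record { n = suc (suc _) } _ = s≤s (s≤s z≤n)

⇒-isJoin : ∀ G H → IsJoin (arc G) (arc (G ⇒ H))
⇒-isJoin G H = record { inside = inside ; forward = forward ; backward = backward }
  where
  inside : ∀ u v → joinArc G H (u ↑ˡ n H) (v ↑ˡ n H) ≡ arc G u v
  inside u v rewrite splitAt-↑ˡ (n G) u (n H) | splitAt-↑ˡ (n G) v (n H) = refl
  forward : ∀ u w → joinArc G H (u ↑ˡ n H) (n G ↑ʳ w) ≡ true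
  forward u w rewrite splitAt-↑ˡ (n G) u (n H) | splitAt-↑ʳ (n G) (n H) w = refl
  backward : ∀ w v → joinArc G H (n G ↑ʳ w) (v ↑ˡ n H) ≡ false
  backward w v rewrite splitAt-↑ʳ (n G) (n H) w | splitAt-↑ˡ (n G) v (n H) = refl

arcCount : ∀ {N} → Adjacency N → ℕ
arcCount {N} p = ∑[ u < N ] ∑[ v < N ] b2n (p u v)

size≡arcCount : ∀ {D} (R : ArcSet D) → size R ≡ arcCount (rarc R)
size≡arcCount R = trans (Σv≡∑ λ u → Σv λ v → b2n (rarc R u v))
                         (sum-cong-≗ λ u → Σv≡∑ λ v → b2n (rarc R u v))

arcsInto↑ˡ≤arcCount : ∀ m {n} (p : Adjacency (m + n)) →
  arcCount (λ u v → p (u ↑ˡ n) (v ↑ˡ n)) + ∑[ w < n ] ∑[ v < m ] b2n (p (m ↑ʳ w) (v ↑ˡ n))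
    ≤ arcCount p
arcsInto↑ˡ≤arcCount m {n} p = ≤-trans
  (+-mono-≤ (∑-mono-≤ λ u → ∑-↑ˡ-≤ m (λ v → b2n (p (u ↑ˡ n) v)))
            (∑-mono-≤ λ w → ∑-↑ˡ-≤ m (λ v → b2n (p (m ↑ʳ w) v))))
  (≤-reflexive (sym (∑-splitAt m (λ u → ∑[ v < m + n ] b2n (p u v)))))

module _ (D : Digraph) (p : Adjacency (n D)) where

  fresh : Adjacency (n D)
  fresh u v = not (arc D u v) ∧ not (does (u ≟ᶠ v)) ∧ p u v

  freshArcs : ArcSet D
  freshArcs = record { rarc = fresh ; rloop = loop ; disjoint = disjoint′ }
    where
    loop : ∀ v → fresh v v ≡ false
    loop v rewrite loopless D v | dec-true (v ≟ᶠ v) refl = refl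
    disjoint′ : ∀ u v → fresh u v ≡ true → arc D u v ≡ false
    disjoint′ u v with arc D u v
    ... | true = λ ()
    ... | false = λ _ → refl

  freshArcs-size : size freshArcs ≤ arcCount p
  freshArcs-size = subst (_≤ arcCount p) (sym (size≡arcCount freshArcs))
    (∑-mono-≤ λ u → ∑-mono-≤ λ v → b2n-mono (fresh⇒p u v))
    where
    fresh⇒p : ∀ u v → fresh u v ≡ true → p u v ≡ true
    fresh⇒p u v with arc D u v | does (u ≟ᶠ v)
    ... | false | false = λ e → e
    ... | false | true = λ ()
    ... | true | _ = λ ()

  freshArcs-covers : ∀ u v → p u v ≡ true → u ≢ v → arc (addArcs D freshArcs) u v ≡ true
  freshArcs-covers u v puv u≢v with arc D u v
  ... | true = refl
  ... | false rewrite dec-false (u ≟ᶠ v) u≢v = puv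

module _ (G H : Digraph) (R : ArcSet G) where

  liftAdj : Adjacency (n G + n H)
  liftAdj u v with splitAt (n G) u | splitAt (n G) v
  ... | inj₁ a | inj₁ b = rarc R a b
  ... | inj₁ _ | inj₂ _ = false
  ... | inj₂ _ | _ = false

  liftAdj-↑ˡ : ∀ a b → liftAdj (a ↑ˡ n H) (b ↑ˡ n H) ≡ rarc R a b
  liftAdj-↑ˡ a b rewrite splitAt-↑ˡ (n G) a (n H) | splitAt-↑ˡ (n G) b (n H) = refl

  liftAdj-↑ˡ↑ʳ : ∀ a w → liftAdj (a ↑ˡ n H) (n G ↑ʳ w) ≡ false
  liftAdj-↑ˡ↑ʳ a w rewrite splitAt-↑ˡ (n G) a (n H) | splitAt-↑ʳ (n G) (n H) w = refl

  liftAdj-↑ʳ : ∀ w v → liftAdj (n G ↑ʳ w) v ≡ false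
  liftAdj-↑ʳ w v rewrite splitAt-↑ʳ (n G) (n H) w = refl

  liftArcs : ArcSet (G ⇒ H)
  liftArcs = record { rarc = liftAdj ; rloop = loop ; disjoint = disjoint′ }
    where
    open IsJoin (⇒-isJoin G H)
    loop : ∀ v → liftAdj v v ≡ false
    loop v with ↑-view (n G) v
    ... | left a = trans (liftAdj-↑ˡ a a) (rloop R a)
    ... | right w = liftAdj-↑ʳ w _
    disjoint′ : ∀ u v → liftAdj u v ≡ true → joinArc G H u v ≡ false
    disjoint′ u v with ↑-view (n G) u | ↑-view (n G) v
    ... | left a | left b = λ e → trans (inside a b) (disjoint R a b (trans (sym (liftAdj-↑ˡ a b)) e))
    ... | left a | right w = λ e → contradiction (trans (sym (liftAdj-↑ˡ↑ʳ a w)) e) λ ()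
    ... | right w | _ = λ e → contradiction (trans (sym (liftAdj-↑ʳ w _)) e) λ ()

  liftArcs-size : size liftArcs ≡ size R
  liftArcs-size = begin
    size liftArcs
      ≡⟨ size≡arcCount liftArcs ⟩
    arcCount liftAdj
      ≡⟨ ∑-supported-↑ˡ (n G) _ (λ w → trans (sum-cong-≗ λ v → cong b2n (liftAdj-↑ʳ w v))
                                              (sum-replicate-zero (n G + n H))) ⟩
    ∑[ a < n G ] ∑[ v < n G + n H ] b2n (liftAdj (a ↑ˡ n H) v)
      ≡⟨ sum-cong-≗ (λ a → ∑-supported-↑ˡ (n G) _ λ w → cong b2n (liftAdj-↑ˡ↑ʳ a w)) ⟩
    ∑[ a < n G ] ∑[ b < n G ] b2n (liftAdj (a ↑ˡ n H) (b ↑ˡ n H))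
      ≡⟨ sum-cong-≗ (λ a → sum-cong-≗ λ b → cong b2n (liftAdj-↑ˡ a b)) ⟩
    arcCount (rarc R)
      ≡⟨ sym (size≡arcCount R) ⟩
    size R ∎
    where open ≡-Reasoning

  liftArcs-isJoin : IsJoin (arc (addArcs G R)) (arc (addArcs (G ⇒ H) liftArcs))
  liftArcs-isJoin = record
    { inside = λ u v → cong₂ _∨_ (inside u v) (liftAdj-↑ˡ u v)
    ; forward = λ u w → cong (_∨ liftAdj (u ↑ˡ n H) (n G ↑ʳ w)) (forward u w)
    ; backward = λ w v → cong₂ _∨_ (backward w v) (liftAdj-↑ʳ w (v ↑ˡ n H))
    }
    where open IsJoin (⇒-isJoin G H)

  liftArcs-reinforces : 2 ≤ n G → IsReinf G R → IsReinf (G ⇒ H) liftArcs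
  liftArcs-reinforces 2≤nG (k , k′ , γk , γk′ , k′<k) =
    k , k′ , Equivalence.from (γI-join (⇒-isJoin G H) 2≤nG k) γk ,
    Equivalence.from (γI-join liftArcs-isJoin 2≤nG k′) γk′ , k′<k

module Projection (G H : Digraph) (R : ArcSet (G ⇒ H)) (x : Fin (n G)) where
  open IsJoin (⇒-isJoin G H)

  private
    ι : Fin (n G) → Fin (n G + n H)
    ι a = a ↑ˡ n H
    ρ : Fin (n H) → Fin (n G + n H)
    ρ h = n G ↑ʳ h

  D′ : Digraph
  D′ = addArcs (G ⇒ H) R

  hitFromH : Fin (n G) → Bool
  hitFromH b = does (any? λ h → rarc R (ρ h) (ι b) Bool.≟ true)

  projectedAdj : Adjacency (n G)
  projectedAdj a b = rarc R (ι a) (ι b) ∨ (does (a ≟ᶠ x) ∧ hitFromH b)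

  R′ : ArcSet G
  R′ = freshArcs G projectedAdj

  G′ : Digraph
  G′ = addArcs G R′

  hitFromH≤ : ∀ b → b2n (hitFromH b) ≤ ∑[ h < n H ] b2n (rarc R (ρ h) (ι b))
  hitFromH≤ b with any? (λ h → rarc R (ρ h) (ι b) Bool.≟ true)
  ... | yes (h , e) = ≤-trans (b2n-mono {true} λ _ → e) (≤-∑ (λ h → b2n (rarc R (ρ h) (ι b))) h)
  ... | no _ = z≤n

  ∑-arcs-from-x : ∑[ a < n G ] ∑[ b < n G ] b2n (does (a ≟ᶠ x) ∧ hitFromH b)
                ≡ ∑[ b < n G ] b2n (hitFromH b)
  ∑-arcs-from-x = trans (∑-focus _ x other)
    (sum-cong-≗ λ b → cong (λ t → b2n (t ∧ hitFromH b)) (dec-true (x ≟ᶠ x) refl))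
    where
    other : ∀ a → a ≢ x → ∑[ b < n G ] b2n (does (a ≟ᶠ x) ∧ hitFromH b) ≡ 0
    other a a≢x rewrite dec-false (a ≟ᶠ x) a≢x = sum-replicate-zero (n G)

  R′-size : size R′ ≤ size R
  R′-size = begin
    size R′
      ≤⟨ freshArcs-size G projectedAdj ⟩
    arcCount projectedAdj
      ≤⟨ ∑-mono-≤ (λ a → ∑-mono-≤ λ b → b2n-∨ (rarc R (ι a) (ι b)) _) ⟩
    ∑[ a < n G ] ∑[ b < n G ] (b2n (rarc R (ι a) (ι b)) + b2n (does (a ≟ᶠ x) ∧ hitFromH b))
      ≡⟨ trans (sum-cong-≗ λ a → ∑-distrib-+ (λ b → b2n (rarc R (ι a) (ι b))) (new a))
               (∑-distrib-+ (λ a → ∑[ b < n G ] b2n (rarc R (ι a) (ι b))) (λ a → sum (new a))) ⟩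
    inG + ∑[ a < n G ] ∑[ b < n G ] b2n (does (a ≟ᶠ x) ∧ hitFromH b)
      ≡⟨ cong (inG +_) ∑-arcs-from-x ⟩
    inG + ∑[ b < n G ] b2n (hitFromH b)
      ≤⟨ +-monoʳ-≤ inG (∑-mono-≤ hitFromH≤) ⟩
    inG + ∑[ b < n G ] ∑[ h < n H ] b2n (rarc R (ρ h) (ι b))
      ≡⟨ cong (inG +_) (∑-comm (λ b h → b2n (rarc R (ρ h) (ι b)))) ⟩
    inG + ∑[ h < n H ] ∑[ b < n G ] b2n (rarc R (ρ h) (ι b))
      ≤⟨ arcsInto↑ˡ≤arcCount (n G) (rarc R) ⟩
    arcCount (rarc R)
      ≡⟨ size≡arcCount R ⟨
    size R ∎
    where
    open ≤-Reasoning
    inG : ℕ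
    inG = arcCount (λ a b → rarc R (ι a) (ι b))
    new : Fin (n G) → Vector ℕ (n G)
    new a b = b2n (does (a ≟ᶠ x) ∧ hitFromH b)

  arc-from-G : ∀ a v → arc D′ (ι a) (ι v) ≡ true → arc G′ a v ≡ true
  arc-from-G a v e with ∨≡true (joinArc G H (ι a) (ι v)) e
  ... | inj₁ arcGH = cong (_∨ rarc R′ a v) (trans (sym (inside a v)) arcGH)
  ... | inj₂ arcR = freshArcs-covers G projectedAdj a v (cong (_∨ (does (a ≟ᶠ x) ∧ hitFromH v)) arcR)
    λ { refl → contradiction (trans (sym arcR) (rloop R (ι a))) λ () }

  arc-from-H⇒hitFromH : ∀ h v → arc D′ (ρ h) (ι v) ≡ true → hitFromH v ≡ true
  arc-from-H⇒hitFromH h v e =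
    dec-true (any? _) (h , subst (λ t → t ∨ rarc R (ρ h) (ι v) ≡ true) (backward h v) e)

  hitFromH⇒arc-from-x : ∀ v → hitFromH v ≡ true → x ≢ v → arc G′ x v ≡ true
  hitFromH⇒arc-from-x v hitv x≢v = freshArcs-covers G projectedAdj x v projectedAdj-xv x≢v
    where
    projectedAdj-xv : projectedAdj x v ≡ true
    projectedAdj-xv rewrite dec-true (x ≟ᶠ x) refl | hitv = Bool.∨-zeroʳ _

  spill : Vector ℕ (n G + n H) → ℕ
  spill f = (∑[ h < n H ] f (ρ h)) ⊓ 2

  lower : Vector ℕ (n G + n H) → Vector ℕ (n G)
  lower f = updateAt (λ a → f (ι a)) x (_+ spill f)

  lower-sum : ∀ f → sum (lower f) ≤ sum f
  lower-sum f = begin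
    sum (lower f)                 ≡⟨ ∑-updateAt-+ (λ a → f (ι a)) x (spill f) ⟩
    ∑fι + spill f                 ≤⟨ +-monoʳ-≤ ∑fι (m⊓n≤m _ 2) ⟩
    ∑fι + sum (λ h → f (ρ h))     ≡⟨ ∑-splitAt (n G) f ⟨
    sum f                         ∎
    where
    open ≤-Reasoning
    ∑fι : ℕ
    ∑fι = sum (λ a → f (ι a))

  fromH : Vector ℕ (n G + n H) → Fin (n G) → ℕ
  fromH f v = ∑[ h < n H ] (b2n (arc D′ (ρ h) (ι v)) * f (ρ h))

  fromH⊓2≤ : ∀ f v → lower f v ≡ 0 → fromH f v ⊓ 2 ≤ b2n (arc G′ x v) * spill f
  fromH⊓2≤ f v lower≡0 with fromH f v ≟ 0
  ... | yes fromH≡0 = subst (λ t → t ⊓ 2 ≤ b2n (arc G′ x v) * spill f) (sym fromH≡0) z≤n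
  ... | no fromH≢0 = subst (fromH f v ⊓ 2 ≤_) spill≡ (⊓-monoˡ-≤ 2 fromH≤)
    where
    fromH≤ : fromH f v ≤ ∑[ h < n H ] f (ρ h)
    fromH≤ = ∑-mono-≤ λ h → b2n-*-≤ (arc D′ (ρ h) (ι v)) (f (ρ h))
    0<spill : 0 < spill f
    0<spill = ⊓-glb (≤-trans (n≢0⇒n>0 fromH≢0) fromH≤) (s≤s z≤n)
    x≢v : x ≢ v
    x≢v refl = <⇒≢ (≤-trans 0<spill (m≤n+m _ _)) (sym (trans (sym (updateAt-updates x _)) lower≡0))
    hitv : hitFromH v ≡ true
    hitv = let h , pos = ∑-positive _ (n≢0⇒n>0 fromH≢0)
           in arc-from-H⇒hitFromH h v (b2n-*-positive _ (f (ρ h)) pos)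
    spill≡ : spill f ≡ b2n (arc G′ x v) * spill f
    spill≡ rewrite hitFromH⇒arc-from-x v hitv x≢v = sym (*-identityˡ _)

  lower-IDF : ∀ f → f (ι x) ≡ 0 → IsIDFOn (arc D′) f → IsIDFOn (arc G′) (lower f)
  lower-IDF f fιx≡0 idf = mkIDF (arc G′) bounded heavy
    where
    lower-≢x : ∀ a → a ≢ x → lower f a ≡ f (ι a)
    lower-≢x a a≢x = updateAt-minimal a x _ a≢x
    bounded : ∀ a → lower f a ≤ 2
    bounded a with a ≟ᶠ x
    ... | yes refl = subst (_≤ 2) (sym (trans (updateAt-updates x _) (cong (_+ spill f) fιx≡0)))
                           (m⊓n≤n _ 2)
    ... | no a≢x = subst (_≤ 2) (sym (lower-≢x a a≢x)) (proj₁ idf (ι a))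
    fιv≡0 : ∀ v → lower f v ≡ 0 → f (ι v) ≡ 0
    fιv≡0 v lower≡0 with v ≟ᶠ x
    ... | yes refl = fιx≡0
    ... | no v≢x = trans (sym (lower-≢x v v≢x)) lower≡0
    heavy : ∀ v → lower f v ≡ 0 → 2 ≤ inWeight (arc G′) (lower f) v
    heavy v lower≡0 = begin
      2
        ≤⟨ ≤-+-⊓ _ (fromH f v) (subst (2 ≤_) (∑-splitAt (n G) _)
                                      (IDF-inWeight (arc D′) idf (fιv≡0 v lower≡0))) ⟩
      ∑[ a < n G ] (b2n (arc D′ (ι a) (ι v)) * f (ι a)) + fromH f v ⊓ 2
        ≤⟨ +-mono-≤ (∑-mono-≤ λ a → *-monoˡ-≤ (f (ι a)) (b2n-mono (arc-from-G a v)))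
                    (fromH⊓2≤ f v lower≡0) ⟩
      inWeight (arc G′) (λ a → f (ι a)) v + b2n (arc G′ x v) * spill f
        ≡⟨ inWeight-updateAt-+ (arc G′) (λ a → f (ι a)) x (spill f) v ⟨
      inWeight (arc G′) (lower f) v ∎
      where open ≤-Reasoning

projectReinforcement : ∀ G H → 2 ≤ n G → (R : ArcSet (G ⇒ H)) → IsReinf (G ⇒ H) R →
                       Σ (ArcSet G) λ R′ → IsReinf G R′ × size R′ ≤ size R
projectReinforcement G H 2≤nG R (k , k′ , γk , ((f , idf , Σvf≡k′) , _) , k′<k) =
  R′ , (k , k″ , γGk , γk″ , ≤-<-trans k″≤k′ k′<k) , R′-size
  where
  γGk : IsγI G k
  γGk = Equivalence.to (γI-join (⇒-isJoin G H) 2≤nG k) γk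
  k≤nG : k ≤ n G
  k≤nG = subst (k ≤_) (trans (Σv≡∑ (replicate (n G) 1)) (∑-ones (n G)))
               (proj₂ γGk _ (IDF-ones (arc G)))
  ∑f≡k′ : sum f ≡ k′
  ∑f≡k′ = trans (sym (Σv≡∑ f)) Σvf≡k′
  zeroOnG : ∃ λ x → f (x ↑ˡ n H) ≡ 0
  zeroOnG = ∑<n⇒∃≡0 (λ a → f (a ↑ˡ n H))
    (<-≤-trans (≤-<-trans (∑-↑ˡ-≤ (n G) f) (subst (_< k) (sym ∑f≡k′) k′<k)) k≤nG)
  open Projection G H R (proj₁ zeroOnG)
  k″ : ℕ
  k″ = proj₁ (γI-exists (arc G′))
  γk″ : IsγI G′ k″
  γk″ = proj₂ (γI-exists (arc G′))
  k″≤k′ : k″ ≤ k′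
  k″≤k′ = begin
    k″              ≤⟨ proj₂ γk″ (lower f) (lower-IDF f (proj₂ zeroOnG) idf) ⟩
    Σv (lower f)    ≡⟨ Σv≡∑ (lower f) ⟩
    sum (lower f)   ≤⟨ lower-sum f ⟩
    sum f           ≡⟨ ∑f≡k′ ⟩
    k′              ∎
    where open ≤-Reasoning

rI-transfer : ∀ D E → (∀ k → IsγI D k ⇔ IsγI E k) →
              (up : ArcSet E → ArcSet D) → (∀ R → IsReinf E R → IsReinf D (up R)) →
              (∀ R → size (up R) ≡ size R) →
              (∀ R → IsReinf D R → Σ (ArcSet E) λ R′ → IsReinf E R′ × size R′ ≤ size R) →
              ∀ r → IsrI D r ⇔ IsrI E r
rI-transfer D E γ⇔ up up-reinf up-size down r = mk⇔ to from
  where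
  to : IsrI D r → IsrI E r
  to (inj₁ (k , γk , k≤2 , r≡0)) = inj₁ (k , Equivalence.to (γ⇔ k) γk , k≤2 , r≡0)
  to (inj₂ ((k , γk , 3≤k) , (R , reinf , size≡r) , minimum)) with down R reinf
  ... | R′ , reinf′ , size≤ =
    inj₂ ((k , Equivalence.to (γ⇔ k) γk , 3≤k) ,
          (R′ , reinf′ , ≤-antisym (≤-trans size≤ (≤-reflexive size≡r)) (minimum′ R′ reinf′)) ,
          minimum′)
    where
    minimum′ : ∀ S → IsReinf E S → r ≤ size S
    minimum′ S reinfS = subst (r ≤_) (up-size S) (minimum (up S) (up-reinf S reinfS))
  from : IsrI E r → IsrI D r
  from (inj₁ (k , γk , k≤2 , r≡0)) = inj₁ (k , Equivalence.from (γ⇔ k) γk , k≤2 , r≡0)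
  from (inj₂ ((k , γk , 3≤k) , (R , reinf , size≡r) , minimum)) =
    inj₂ ((k , Equivalence.from (γ⇔ k) γk , 3≤k) ,
          (up R , up-reinf R reinf , trans (up-size R) size≡r) ,
          λ S reinfS → let S′ , reinfS′ , size≤ = down S reinfS
                       in ≤-trans (minimum S′ reinfS′) size≤)

theorem4p6 : (G H : Digraph) → 1 ≤ Δ⁺ G → 1 ≤ Δ⁺ H →
    (∀ k → IsγI (G ⇒ H) k ⇔ IsγI G k) × (∀ r → IsrI (G ⇒ H) r ⇔ IsrI G r)
theorem4p6 G H 1≤Δ⁺G _ =
  γ-equal ,
  rI-transfer (G ⇒ H) G γ-equal (liftArcs G H) (λ R → liftArcs-reinforces G H R 2≤nG)
              (liftArcs-size G H) (projectReinforcement G H 2≤nG)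
  where
  2≤nG : 2 ≤ n G
  2≤nG = Δ⁺≥1⇒2≤n G 1≤Δ⁺G
  γ-equal : ∀ k → IsγI (G ⇒ H) k ⇔ IsγI G k
  γ-equal = γI-join (⇒-isJoin G H) 2≤nG
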